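{- Let $n\ge 2$ and $A\in T_{n+2}$, and let $\lambda_1(A)\ge\lambda_2(A)\ge\dots\ge\lambda_{n-1}(A)$ be the tails of the diagonals of $A$ in decreasing order. Then $\lambda_k(A)\le n-k$ for every $1\le k\le n-1$.
   Context: Label the vertices of a convex $(n+2)$-gon $0,1,\dots,n+1$ counterclockwise. $T_{n+2}$ is the set of its triangulations: sets of diagonals, pairwise either sharing an endpoint or non-intersecting, dividing the polygon into triangles (each has $n-1$ diagonals). The tail of a diagonal is its smaller endpoint. -}

module Defs where

open import Data.Nat using (ℕ; zero; suc; _+_; _≤_; _<_)
open import Data.Nat.Properties using (≤-decTotalOrder)
open import Data.Fin using (Fin; toℕ)
open import Data.Product using (_×_; _,_; proj₁; proj₂; ∃-syntax)
open import Data.Sum using (_⊎_)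
open import Data.List using (List; map; reverse)
open import Data.List.Membership.Propositional using (_∈_; _∉_)
open import Data.List.Relation.Unary.All using (All)
open import Data.List.Relation.Unary.Unique.Propositional using (Unique)
open import Relation.Binary.PropositionalEquality using (_≡_)
open import Relation.Nullary using (¬_)
import Data.List.Sort as Sort

-- Vertices of the convex (n+2)-gon, labelled 0,1,…,n+1 counterclockwise.
Vertex : ℕ → Set
Vertex n = Fin (suc (suc n))

-- A diagonal is stored as the ordered pair (tail , head) with tail < head.
Diag : ℕ → Set
Diag n = Vertex n × Vertex n

-- (a , b) is a diagonal: a < b, the endpoints are not adjacent on the polygon
-- (b ≠ a+1, and not the side {0, n+1}).
IsDiagonal : (n : ℕ) → Diag n → Set
IsDiagonal n (a , b) = (suc (suc (toℕ a)) ≤ toℕ b) × ¬ ((toℕ a ≡ 0) × (toℕ b ≡ suc n))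

-- Two diagonals cross (intersect in their interiors): their endpoints
-- strictly interleave around the polygon.
Cross : {n : ℕ} → Diag n → Diag n → Set
Cross (a , b) (c , d) =
  (toℕ a < toℕ c × toℕ c < toℕ b × toℕ b < toℕ d)
  ⊎ (toℕ c < toℕ a × toℕ a < toℕ d × toℕ d < toℕ b)

-- A triangulation: a set (duplicate-free list) of diagonals, pairwise
-- non-crossing (they either share an endpoint or do not intersect), which
-- is maximal with this property, i.e. divides the polygon into triangles.
record IsTriangulation (n : ℕ) (D : List (Diag n)) : Set where
  field
    diagonals   : All (IsDiagonal n) D
    distinct    : Unique D
    noncrossing : ∀ {x y} → x ∈ D → y ∈ D → ¬ Cross x y
    maximal     : ∀ (x : Diag n) → IsDiagonal n x → x ∉ D →
                  ∃[ y ] (y ∈ D × Cross x y)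

tail : {n : ℕ} → Diag n → ℕ
tail (a , b) = toℕ a

open Sort ≤-decTotalOrder using (sort)

-- λ(A) : the tails of the diagonals of A in decreasing order
-- (entry at position i is λ_{i+1}(A)).
tailsDecreasing : {n : ℕ} → List (Diag n) → List ℕ
tailsDecreasing D = reverse (sort (map tail D))

-- The heart of the proof is a counting bound: for every v, at most n − v
-- diagonals of a triangulation have tail ≥ v.  It holds for any duplicate-free
-- family F of pairwise non-crossing diagonals.  To each x = (a , b) ∈ F we
-- attach its pivot: the largest head d < b of a diagonal (a , d) ∈ F, or a + 1
-- if there is none.  The pivot lies strictly between a and b, and the map
-- x ↦ pivot x is injective on F: two diagonals with the same tail are separated
-- by their heads, and two diagonals with different tails and a common pivot
-- would force a crossing.  So if all tails are ≥ v, the pivots are distinct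
-- numbers in (v , n], and a pigeonhole argument bounds |F| by n − v.
--
-- The theorem follows: in the non-increasing list λ(A) the entry λ_k = v at
-- position k is preceded (inclusively) by k entries ≥ v, so k ≤ n − v, which
-- rearranges to v ≤ n − k.
module Submission where

open import Defs
open import Data.Nat using (ℕ; suc; _≤_; _∸_; _<_; _≥_; z≤n; s≤s; _≤?_; _<?_)
open import Data.Nat.Properties
  using (≤-decTotalOrder; ≤-refl; ≤-trans; <-≤-trans; ≤-<-trans; <-irrefl; ≤-pred;
         ≤∧≢⇒<; <-cmp; _≟_; ∸-monoʳ-<; +-comm; m+n≤o⇒m≤o∸n; m≤o∸n⇒m+n≤o; m≤n⇒m∸n≡0; ≮⇒≥; <⇒≤; module ≤-Reasoning)
open import Data.Fin using (Fin; toℕ)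
open import Data.Fin.Properties using (toℕ-injective; toℕ<n)
open import Data.List using (List; length; lookup; []; _∷_; map; filter; reverse)
open import Data.List.Properties using (filter-accept; unfold-reverse; length-map)
open import Data.List.Extrema.Nat using (max; ⊥≤max; xs≤max; max<v⁺; argmax-sel)
open import Data.List.Membership.Propositional using (_∈_)
open import Data.List.Membership.Propositional.Properties using (∈-filter⁺; ∈-filter⁻; ∈-map⁺; ∈-map⁻; ∈-lookup)
open import Data.List.Relation.Unary.Any using (here; there)
open import Data.List.Relation.Unary.All as All using (All; []; _∷_)
import Data.List.Relation.Unary.All.Properties as All
open import Data.List.Relation.Unary.AllPairs as AllPairs using (AllPairs; []; _∷_)
import Data.List.Relation.Unary.AllPairs.Properties as AllPairs
open import Data.List.Relation.Unary.Linked.Properties using (Linked⇒AllPairs)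
open import Data.List.Relation.Unary.Unique.Propositional using (Unique)
import Data.List.Relation.Unary.Unique.Propositional.Properties as Unique
open import Data.List.Relation.Binary.Permutation.Propositional using (_↭_; ↭-sym; ↭-trans; ↭⇒↭ₛ)
open import Data.List.Relation.Binary.Permutation.Propositional.Properties
  using (All-resp-↭; filter-↭; ↭-length; ↭-reverse)
import Data.List.Relation.Binary.Permutation.Setoid.Properties as SetoidPerm
import Data.List.Sort as Sort
open import Data.Product using (_×_; _,_; proj₁; ∃-syntax; uncurry)
open import Data.Sum using (_⊎_; inj₁; inj₂)
open import Data.Empty using (⊥-elim)
open import Function using (flip)
open import Relation.Nullary using (¬_; Dec; yes; no; contradiction)
open import Relation.Nullary.Decidable using (_×-dec_)
open import Relation.Binary.Definitions using (tri<; tri≈; tri>)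
open import Relation.Binary.PropositionalEquality
  using (_≡_; _≢_; refl; sym; trans; cong; cong₂; subst; setoid)

open Sort ≤-decTotalOrder using (sort; sort-↭; sort-↗)
open SetoidPerm (setoid ℕ) using (Unique-resp-↭)

countAtLeast : ℕ → List ℕ → ℕ
countAtLeast v xs = length (filter (v ≤?_) xs)

countAtLeast-↭ : ∀ v {xs ys : List ℕ} → xs ↭ ys → countAtLeast v xs ≡ countAtLeast v ys
countAtLeast-↭ v p = ↭-length (filter-↭ (v ≤?_) p)

filter-map : ∀ {A B : Set} {P : B → Set} (P? : ∀ y → Dec (P y)) (f : A → B) (xs : List A) →
             filter P? (map f xs) ≡ map f (filter (λ x → P? (f x)) xs)
filter-map P? f [] = refl
filter-map P? f (x ∷ xs) with P? (f x)
... | yes _ = cong (f x ∷_) (filter-map P? f xs)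
... | no _ = filter-map P? f xs

AllPairs-reverse : ∀ {A : Set} {R : A → A → Set} {xs : List A} →
                   AllPairs R xs → AllPairs (flip R) (reverse xs)
AllPairs-reverse [] = []
AllPairs-reverse {xs = x ∷ xs} (Rx ∷ Rxs) rewrite unfold-reverse x xs =
  AllPairs.++⁺ (AllPairs-reverse Rxs) ([] ∷ [])
    (All-resp-↭ (↭-sym (↭-reverse xs)) (All.map (_∷ []) Rx))

position<countAtLeast : ∀ (xs : List ℕ) → AllPairs _≥_ xs → (i : Fin (length xs)) →
                        suc (toℕ i) ≤ countAtLeast (lookup xs i) xs
position<countAtLeast (x ∷ xs) (_ ∷ _) Fin.zero
  rewrite filter-accept (x ≤?_) {x} {xs} ≤-refl = s≤s z≤n
position<countAtLeast (x ∷ xs) (x≥xs ∷ desc) (Fin.suc i)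
  rewrite filter-accept (lookup xs i ≤?_) {x} {xs} (All.lookup x≥xs (∈-lookup i)) =
  s≤s (position<countAtLeast xs desc i)

increasing-length≤ : ∀ lo hi (xs : List ℕ) → AllPairs _<_ xs →
                     All (λ x → lo < x × x ≤ hi) xs → length xs ≤ hi ∸ lo
increasing-length≤ lo hi [] _ _ = z≤n
increasing-length≤ lo hi (x ∷ xs) (x<xs ∷ incr) ((lo<x , x≤hi) ∷ inRange) =
  ≤-trans (s≤s (increasing-length≤ x hi xs incr (All.zipWith above-x (x<xs , inRange))))
          (∸-monoʳ-< lo<x x≤hi)
  where
  above-x : ∀ {y} → x < y × lo < y × y ≤ hi → x < y × y ≤ hi
  above-x (x<y , _ , y≤hi) = x<y , y≤hi

-- Pigeonhole: distinct naturals in (lo , hi] number at most hi − lo.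
-- Sorting turns the list into a strictly increasing one.
distinct-length≤ : ∀ lo hi (xs : List ℕ) → Unique xs →
                   All (λ x → lo < x × x ≤ hi) xs → length xs ≤ hi ∸ lo
distinct-length≤ lo hi xs distinct inRange =
  subst (_≤ hi ∸ lo) (↭-length (sort-↭ xs))
    (increasing-length≤ lo hi (sort xs) increasing (All-resp-↭ (↭-sym (sort-↭ xs)) inRange))
  where
  increasing : AllPairs _<_ (sort xs)
  increasing = AllPairs.zipWith (uncurry ≤∧≢⇒<)
    ( Linked⇒AllPairs ≤-trans (sort-↗ xs)
    , Unique-resp-↭ (↭⇒↭ₛ (↭-sym (sort-↭ xs))) distinct)

Unique-map-on : ∀ {A B : Set} (f : A → B) {xs : List A} →
                (∀ {x y} → x ∈ xs → y ∈ xs → f x ≡ f y → x ≡ y) →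
                Unique xs → Unique (map f xs)
Unique-map-on f inj [] = []
Unique-map-on f inj (x≢xs ∷ distinct) =
  All.map⁺ (All.tabulate λ y∈xs fx≡fy → All.lookup x≢xs y∈xs (inj (here refl) (there y∈xs) fx≡fy))
  ∷ Unique-map-on f (λ x∈ y∈ → inj (there x∈) (there y∈)) distinct

module Pivot {n : ℕ} where

  head : Diag n → ℕ
  head (_ , b) = toℕ b

  Nested : Diag n → Diag n → Set
  Nested x y = tail y ≡ tail x × head y < head x

  nested? : ∀ x y → Dec (Nested x y)
  nested? x y = (tail y ≟ tail x) ×-dec (head y <? head x)

  innerHeads : List (Diag n) → Diag n → List ℕ
  innerHeads F x = map head (filter (nested? x) F)

  innerHeads⁺ : ∀ {F x y} → y ∈ F → Nested x y → head y ∈ innerHeads F x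
  innerHeads⁺ {x = x} y∈F nested = ∈-map⁺ head (∈-filter⁺ (nested? x) y∈F nested)

  innerHeads⁻ : ∀ {F x d} → d ∈ innerHeads F x → ∃[ y ] (y ∈ F × Nested x y × d ≡ head y)
  innerHeads⁻ {F} {x} d∈ with ∈-map⁻ head d∈
  ... | y , y∈filter , d≡ with ∈-filter⁻ (nested? x) {xs = F} y∈filter
  ...   | y∈F , nested = y , y∈F , nested , d≡

  pivot : List (Diag n) → Diag n → ℕ
  pivot F x = max (suc (tail x)) (innerHeads F x)

  pivot-above-tail : ∀ F x → tail x < pivot F x
  pivot-above-tail F x = ⊥≤max (suc (tail x)) (innerHeads F x)

  pivot-below-head : ∀ F x → IsDiagonal n x → pivot F x < head x
  pivot-below-head F x (tail+2≤head , _) =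
    max<v⁺ tail+2≤head (All.tabulate λ d∈ → case (innerHeads⁻ d∈))
    where
    case : ∀ {d} → ∃[ y ] (y ∈ F × Nested x y × d ≡ head y) → d < head x
    case (_ , _ , (_ , head<) , refl) = head<

  pivot-above-nested : ∀ {F x y} → y ∈ F → Nested x y → head y ≤ pivot F x
  pivot-above-nested {F} {x} y∈F nested =
    All.lookup (xs≤max (suc (tail x)) (innerHeads F x)) (innerHeads⁺ y∈F nested)

  pivot-cases : ∀ F x → pivot F x ≡ suc (tail x) ⊎ ∃[ y ] (y ∈ F × Nested x y × pivot F x ≡ head y)
  pivot-cases F x with argmax-sel (λ d → d) (suc (tail x)) (innerHeads F x)
  ... | inj₁ default = inj₁ default
  ... | inj₂ inner   = inj₂ (innerHeads⁻ inner)

  module _ {F : List (Diag n)}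
           (diagonals : All (IsDiagonal n) F)
           (noncrossing : ∀ {x y} → x ∈ F → y ∈ F → ¬ Cross x y) where

    -- Diagonals with different tails have different pivots: a common pivot
    -- c = head z of some z nested in x would make z cross y.
    pivot-distinct-tails : ∀ {x y} → x ∈ F → y ∈ F → tail x < tail y → pivot F x ≢ pivot F y
    pivot-distinct-tails {x} {y@(c , d)} x∈F y∈F tx<ty same with pivot-cases F x
    ... | inj₁ default =
      <-irrefl refl (<-≤-trans (subst (tail y <_) (trans (sym same) default) (pivot-above-tail F y)) tx<ty)
    ... | inj₂ (z@(_ , _) , z∈F , (tz≡tx , _) , pivot≡head) =
      noncrossing z∈F y∈F (inj₁
        ( subst (_< toℕ c) (sym tz≡tx) tx<ty
        , subst (toℕ c <_) (trans (sym same) pivot≡head) (pivot-above-tail F y)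
        , subst (_< toℕ d) (trans (sym same) pivot≡head) (pivot-below-head F y (All.lookup diagonals y∈F))))

    -- Diagonals with the same tail have different pivots: the shorter one is
    -- nested in the longer one, whose pivot is therefore larger.
    pivot-distinct-heads : ∀ {x y} → x ∈ F → y ∈ F → tail x ≡ tail y → head x < head y → pivot F x ≢ pivot F y
    pivot-distinct-heads {x} {y} x∈F y∈F tx≡ty hx<hy same =
      <-irrefl same (<-≤-trans (pivot-below-head F x (All.lookup diagonals x∈F)) hx≤pivot)
      where
      hx≤pivot : head x ≤ pivot F y
      hx≤pivot = pivot-above-nested x∈F (tx≡ty , hx<hy)

    pivot-injective : ∀ {x y} → x ∈ F → y ∈ F → pivot F x ≡ pivot F y → x ≡ y
    pivot-injective {a , b} {c , d} x∈F y∈F same with <-cmp (toℕ a) (toℕ c)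
    ... | tri< lt _ _ = ⊥-elim (pivot-distinct-tails x∈F y∈F lt same)
    ... | tri> _ _ gt = ⊥-elim (pivot-distinct-tails y∈F x∈F gt (sym same))
    ... | tri≈ _ a≡c _ with <-cmp (toℕ b) (toℕ d)
    ...   | tri< lt _ _ = ⊥-elim (pivot-distinct-heads x∈F y∈F a≡c lt same)
    ...   | tri> _ _ gt = ⊥-elim (pivot-distinct-heads y∈F x∈F (sym a≡c) gt (sym same))
    ...   | tri≈ _ b≡d _ = cong₂ _,_ (toℕ-injective a≡c) (toℕ-injective b≡d)

    -- Counting bound: a duplicate-free non-crossing family of diagonals whose
    -- tails are all ≥ v has at most n − v members (its pivots are distinct
    -- numbers in (v , n]).
    noncrossing-length≤ : ∀ v → Unique F → All (λ x → v ≤ tail x) F → length F ≤ n ∸ v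
    noncrossing-length≤ v distinct tails≥v =
      subst (_≤ n ∸ v) (length-map (pivot F) F)
        (distinct-length≤ v n (map (pivot F) F)
          (Unique-map-on (pivot F) pivot-injective distinct)
          (All.map⁺ (All.tabulate pivot-in-range)))
      where
      pivot-in-range : ∀ {x} → x ∈ F → v < pivot F x × pivot F x ≤ n
      pivot-in-range {x@(_ , b)} x∈F =
        ≤-<-trans (All.lookup tails≥v x∈F) (pivot-above-tail F x) ,
        ≤-pred (≤-trans (pivot-below-head F x (All.lookup diagonals x∈F)) (≤-pred (toℕ<n b)))

open Pivot using (noncrossing-length≤)

tailsAtLeast≤ : ∀ n (A : List (Diag n)) → IsTriangulation n A → ∀ v →
                countAtLeast v (map tail A) ≤ n ∸ v
tailsAtLeast≤ n A T v = begin
  countAtLeast v (map tail A)  ≡⟨ cong length (filter-map (v ≤?_) tail A) ⟩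
  length (map tail F)          ≡⟨ length-map tail F ⟩
  length F                     ≤⟨ noncrossing-length≤ (All.filter⁺ atLeast? diagonals)
                                    (λ x∈F y∈F → noncrossing (F⊆A x∈F) (F⊆A y∈F))
                                    v (Unique.filter⁺ atLeast? distinct) (All.all-filter atLeast? A) ⟩
  n ∸ v                        ∎
  where
  open ≤-Reasoning
  open IsTriangulation T
  atLeast? : (x : Diag n) → Dec (v ≤ tail x)
  atLeast? x = v ≤? tail x
  F : List (Diag n)
  F = filter atLeast? A
  F⊆A : ∀ {x} → x ∈ F → x ∈ A
  F⊆A x∈F = proj₁ (∈-filter⁻ atLeast? x∈F)

∸-swap : ∀ n k v → suc k ≤ n ∸ v → v ≤ n ∸ suc k
∸-swap n k v k<n∸v = m+n≤o⇒m≤o∸n v (subst (_≤ n) (+-comm (suc k) v) (m≤o∸n⇒m+n≤o (suc k) v≤n k<n∸v))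
  where
  v≤n : v ≤ n
  v≤n = ≮⇒≥ λ n<v → contradiction (subst (suc k ≤_) (m≤n⇒m∸n≡0 (<⇒≤ n<v)) k<n∸v) λ ()

lemma2 : (n : ℕ) → 2 ≤ n → (A : List (Diag n)) → IsTriangulation n A →
    (i : Fin (length (tailsDecreasing A))) →
    lookup (tailsDecreasing A) i ≤ n ∸ suc (toℕ i)
lemma2 n _ A T i = ∸-swap n (toℕ i) v (begin
  suc (toℕ i)                  ≤⟨ position<countAtLeast λA descending i ⟩
  countAtLeast v λA            ≡⟨ countAtLeast-↭ v λA↭tails ⟩
  countAtLeast v (map tail A)  ≤⟨ tailsAtLeast≤ n A T v ⟩
  n ∸ v                        ∎)
  where
  open ≤-Reasoning
  λA : List ℕ
  λA = tailsDecreasing A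
  v : ℕ
  v = lookup λA i
  λA↭tails : λA ↭ map tail A
  λA↭tails = ↭-trans (↭-reverse _) (sort-↭ (map tail A))
  descending : AllPairs _≥_ λA
  descending = AllPairs-reverse (Linked⇒AllPairs ≤-trans (sort-↗ (map tail A)))
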